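{- Let $k,l\ge2$ be integers and let $t=a^kb^l$ ($k$ copies of $a$ followed by $l$ copies of $b$, with $a\ne b$). Then every finite simple graph is $t$-representable.
   Context: Two words are isomorphic if one is obtained from the other by a bijective renaming of letters. For a word $w$ and letters $x,y$, $w|_{xy}$ denotes the subword of $w$ consisting of all occurrences of $x$ and $y$ (in order). A word $u$ over the two letters $\{a,b\}$ occurs in $w|_{xy}$ ($x\neq y$) if some contiguous factor of $w|_{xy}$ is isomorphic to $u$; otherwise $w|_{xy}$ avoids $u$. For a word $t$ on two letters, a graph $G=(V,E)$ is $t$-representable if there is a word $w$ over the alphabet $V$ containing each letter of $V$ at least once such that for all distinct $x,y\in V$, $xy\in E$ if and only if $w|_{xy}$ avoids $t$. -}

module Defs where

open import Data.Nat using (ℕ)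
open import Data.Fin using (Fin; _≟_)
open import Data.Bool using (Bool; true; false; _∨_)
open import Data.List using (List; []; _∷_; _++_; map; filter; replicate)
open import Data.List.Membership.Propositional using (_∈_)
open import Data.Product using (Σ; ∃; _×_; _,_)
open import Relation.Nullary using (¬_; Dec; yes; no)
open import Relation.Nullary.Decidable using (_⊎-dec_)
open import Relation.Binary.PropositionalEquality using (_≡_; _≢_)
open import Function.Definitions using (Injective)
open import Function.Bundles using (_⇔_)

-- Words over the two-letter alphabet {a,b}: a = false, b = true.
-- The pattern t = a^k b^l.
pattern-akbl : ℕ → ℕ → List Bool
pattern-akbl k l = replicate k false ++ replicate l true

restrict : {n : ℕ} → List (Fin n) → Fin n → Fin n → List (Fin n)
restrict w x y = filter (λ c → (c ≟ x) ⊎-dec (c ≟ y)) w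

Isomorphic : {n : ℕ} → List Bool → List (Fin n) → Set
Isomorphic {n} u v = Σ (Bool → Fin n) λ f → Injective _≡_ _≡_ f × map f u ≡ v

Occurs : {n : ℕ} → List Bool → List (Fin n) → Set
Occurs {n} u v =
  Σ (List (Fin n)) λ p → Σ (List (Fin n)) λ f → Σ (List (Fin n)) λ s →
    (p ++ f ++ s ≡ v) × Isomorphic u f

Avoids : {n : ℕ} → List Bool → List (Fin n) → Set
Avoids u v = ¬ Occurs u v

record SimpleGraph (n : ℕ) : Set where
  field
    adj    : Fin n → Fin n → Bool
    sym    : ∀ x y → adj x y ≡ adj y x
    irrefl : ∀ x → adj x x ≡ false

Representable : List Bool → {n : ℕ} → SimpleGraph n → Set
Representable t {n} G =
  Σ (List (Fin n)) λ w →
    (∀ (x : Fin n) → x ∈ w) ×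
    (∀ (x y : Fin n) → x ≢ y → (SimpleGraph.adj G x y ≡ true ⇔ Avoids t (restrict w x y)))

module Submission where

-- Every finite simple graph G on n vertices is a^k b^l-representable when
-- k, l ≥ 2.  Writing S for the separator allFin n ++ allFin n, we take
--
--   w = S ++ ∏_{(u,v)} (B(u,v) ++ S),   B(u,v) = u^k v^l if u ≠ v are
--                                        non-adjacent, and empty otherwise.
--
-- * If x ≠ y are non-adjacent, B(x,y) = x^k y^l survives in w|xy, so w|xy
--   contains a^k b^l.
-- * If x, z are adjacent, every restricted block B(u,v)|xz is a power c'^m of
--   a single letter (both endpoints of a non-edge cannot lie in {x,z}) and
--   S|xz = c d c d with {c,d} = {x,z}.  So w|xz is c d c d followed by words
--   c'^m c d c d.  A three-state run scanner (a deterministic automaton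
--   tracking whether the last runs of equal letters are long) returns to the
--   same state after every such piece, and it dies on every factor ααββ; hence
--   w|xz avoids aabb, a factor of a^k b^l, and therefore avoids a^k b^l.

open import Defs
open import Data.Nat using (ℕ; zero; suc; _≤_; s≤s; z≤n)
open import Data.Fin using (Fin; _≟_)
open import Data.Bool using (Bool; true; false; if_then_else_)
open import Data.List using (List; []; _∷_; _++_; map; replicate; foldl; concatMap; allFin; cartesianProduct)
open import Data.List.Properties using (++-assoc; ++-identityʳ; map-++; map-replicate; foldl-++; concatMap-++; filter-++; filter-accept; filter-reject; filter-all; filter-none; filter-≐)
open import Data.List.Membership.Propositional using (_∈_; _∉_)
open import Data.List.Membership.Propositional.Properties using (∈-allFin; ∈-++⁺ˡ; ∈-∃++; ∈-cartesianProduct⁺)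
open import Data.List.Relation.Unary.Any using (here; there)
open import Data.List.Relation.Unary.All as All using ()
open import Data.List.Relation.Unary.All.Properties using (replicate⁺)
open import Data.List.Relation.Unary.AllPairs using (_∷_)
open import Data.List.Relation.Unary.Unique.Propositional using (Unique)
open import Data.List.Relation.Unary.Unique.Propositional.Properties using (allFin⁺)
open import Data.Product using (Σ; ∃; ∃₂; _×_; _,_)
open import Data.Sum as Sum using (_⊎_; inj₁; inj₂)
open import Data.Empty using (⊥-elim)
open import Relation.Nullary using (¬_; yes; no)
open import Relation.Nullary.Decidable using (_⊎-dec_)
open import Relation.Unary using (Decidable)
open import Relation.Binary.Definitions using (DecidableEquality)
open import Relation.Binary.PropositionalEquality using (_≡_; _≢_; refl; sym; trans; cong; cong₂; subst; module ≡-Reasoning)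
open import Function using (_∘_)
open import Function.Bundles using (mk⇔)

pattern-middle : ∀ k' l' → pattern-akbl (suc (suc k')) (suc (suc l')) ≡
                 replicate k' false ++ (false ∷ false ∷ true ∷ true ∷ []) ++ replicate l' true
pattern-middle zero    l' = refl
pattern-middle (suc k') l' = cong (false ∷_) (pattern-middle k' l')

module _ {n : ℕ} where

  occurs-in-factor : ∀ {u : List Bool} {f : List (Fin n)} p s →
                     Isomorphic u f → Occurs u (p ++ f ++ s)
  occurs-in-factor p s iso = p , _ , s , refl , iso

  occurs-factor : ∀ p' u s' {v : List (Fin n)} → Occurs (p' ++ u ++ s') v → Occurs u v
  occurs-factor p' u s' (p , _ , s , refl , g , inj , refl) =
    p ++ map g p' , map g u , map g s' ++ s , shift , g , inj , refl
    where
    open ≡-Reasoning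
    shift : (p ++ map g p') ++ map g u ++ map g s' ++ s ≡ p ++ map g (p' ++ u ++ s') ++ s
    shift = begin
      (p ++ map g p') ++ map g u ++ map g s' ++ s
        ≡⟨ ++-assoc p (map g p') _ ⟩
      p ++ map g p' ++ map g u ++ map g s' ++ s
        ≡⟨ cong (λ r → p ++ map g p' ++ r) (sym (++-assoc (map g u) (map g s') s)) ⟩
      p ++ map g p' ++ (map g u ++ map g s') ++ s
        ≡⟨ cong (p ++_) (sym (++-assoc (map g p') _ s)) ⟩
      p ++ (map g p' ++ map g u ++ map g s') ++ s
        ≡⟨ cong (λ r → p ++ (map g p' ++ r) ++ s) (sym (map-++ g u s')) ⟩
      p ++ (map g p' ++ map g (u ++ s')) ++ s
        ≡⟨ cong (λ r → p ++ r ++ s) (sym (map-++ g p' (u ++ s'))) ⟩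
      p ++ map g (p' ++ u ++ s') ++ s ∎

  occurs-aabb : ∀ {v : List (Fin n)} → Occurs (false ∷ false ∷ true ∷ true ∷ []) v →
                Σ (Fin n) λ α → Σ (Fin n) λ β → ∃₂ λ p s →
                  α ≢ β × v ≡ p ++ (α ∷ α ∷ β ∷ β ∷ []) ++ s
  occurs-aabb (p , _ , s , refl , g , inj , refl) = g false , g true , p , s , distinct , refl
    where
    distinct : g false ≢ g true
    distinct e with inj e
    ... | ()

  two-letter-isomorphic : ∀ k l {x y : Fin n} → x ≢ y →
                          Isomorphic (pattern-akbl k l) (replicate k x ++ replicate l y)
  two-letter-isomorphic k l {x} {y} x≢y = rename , injective , renamed
    where
    rename : Bool → Fin n
    rename b = if b then y else x
    injective : ∀ {a b} → rename a ≡ rename b → a ≡ b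
    injective {false} {false} _ = refl
    injective {false} {true}  e = ⊥-elim (x≢y e)
    injective {true}  {false} e = ⊥-elim (x≢y (sym e))
    injective {true}  {true}  _ = refl
    renamed : map rename (pattern-akbl k l) ≡ replicate k x ++ replicate l y
    renamed = trans (map-++ rename (replicate k false) (replicate l true))
                    (cong₂ _++_ (map-replicate rename k false) (map-replicate rename l true))

-- The run scanner: a deterministic automaton over any alphabet with
-- decidable equality which dies when the word read so far contains a factor
-- ααββ with α ≠ β (only this direction is needed).  It records the last letter and whether the last
-- run of equal letters, and the run before it, are long (length ≥ 2).

module Scanner {A : Set} (_≟ᴬ_ : DecidableEquality A) where

  data RunKind : Set where
    short          : RunKind  -- length one, not preceded by a long run
    shortAfterLong : RunKind  -- length one, preceded by a run of length ≥ 2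
    long           : RunKind

  data State : Set where
    start  : State
    ending : A → RunKind → State
    dead   : State

  next : RunKind → RunKind
  next long = shortAfterLong
  next _    = short

  -- Lengthening the last run: a second long run right after a long one dies.
  extend : A → RunKind → State
  extend e shortAfterLong = dead
  extend e _              = ending e long

  step : State → A → State
  step start        c = ending c short
  step dead         c = dead
  step (ending e r) c with c ≟ᴬ e
  ... | yes _ = extend e r
  ... | no  _ = ending c (next r)

  run : State → List A → State
  run = foldl step

  Accepted : List A → Set
  Accepted v = run start v ≢ dead

  step-same : ∀ e r → step (ending e r) e ≡ extend e r
  step-same e r with e ≟ᴬ e
  ... | yes _   = refl
  ... | no  e≢e = ⊥-elim (e≢e refl)

  step-other : ∀ {c e} r → c ≢ e → step (ending e r) c ≡ ending c (next r)
  step-other {c} {e} r c≢e with c ≟ᴬ e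
  ... | yes c≡e = ⊥-elim (c≢e c≡e)
  ... | no  _   = refl

  run-dead : ∀ v → run dead v ≡ dead
  run-dead []      = refl
  run-dead (_ ∷ v) = run-dead v

  ends-with : ∀ s α → (∃ λ r → step s α ≡ ending α r) ⊎ step s α ≡ dead
  ends-with start        α = inj₁ (short , refl)
  ends-with dead         α = inj₂ refl
  ends-with (ending e r) α with α ≟ᴬ e
  ends-with (ending e short)          α | yes refl = inj₁ (long , refl)
  ends-with (ending e long)           α | yes refl = inj₁ (long , refl)
  ends-with (ending e shortAfterLong) α | yes refl = inj₂ refl
  ... | no _ = inj₁ (next r , refl)

  LongOrDead : A → State → Set
  LongOrDead α s = s ≡ ending α long ⊎ s ≡ dead

  extend-long-or-dead : ∀ α r → LongOrDead α (extend α r)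
  extend-long-or-dead α short          = inj₁ refl
  extend-long-or-dead α shortAfterLong = inj₂ refl
  extend-long-or-dead α long           = inj₁ refl

  read-double : ∀ s α → LongOrDead α (run s (α ∷ α ∷ []))
  read-double s α with ends-with s α
  ... | inj₁ (r , e) = subst (λ s' → LongOrDead α (step s' α)) (sym e)
                             (subst (LongOrDead α) (sym (step-same α r)) (extend-long-or-dead α r))
  ... | inj₂ e = inj₂ (cong (λ s' → step s' α) e)

  long-then-double : ∀ {α β} → α ≢ β → run (ending α long) (β ∷ β ∷ []) ≡ dead
  long-then-double {α} {β} α≢β =
    trans (cong (λ s → step s β) (step-other long (α≢β ∘ sym))) (step-same β shortAfterLong)

  aabb-dead : ∀ s {α β} → α ≢ β → run s (α ∷ α ∷ β ∷ β ∷ []) ≡ dead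
  aabb-dead s {α} {β} α≢β with read-double s α
  ... | inj₁ e = trans (cong (λ s' → run s' (β ∷ β ∷ [])) e) (long-then-double α≢β)
  ... | inj₂ e = cong (λ s' → run s' (β ∷ β ∷ [])) e

  accepted-no-aabb : ∀ {v} p s {α β} → α ≢ β → v ≡ p ++ (α ∷ α ∷ β ∷ β ∷ []) ++ s → ¬ Accepted v
  accepted-no-aabb p s {α} {β} α≢β refl accepted = accepted (begin
      run start (p ++ (α ∷ α ∷ β ∷ β ∷ []) ++ s)
        ≡⟨ foldl-++ step start p _ ⟩
      run (run start p) ((α ∷ α ∷ β ∷ β ∷ []) ++ s)
        ≡⟨ foldl-++ step (run start p) (α ∷ α ∷ β ∷ β ∷ []) s ⟩
      run (run (run start p) (α ∷ α ∷ β ∷ β ∷ [])) s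
        ≡⟨ cong (λ s' → run s' s) (aabb-dead (run start p) α≢β) ⟩
      run dead s
        ≡⟨ run-dead s ⟩
      dead ∎)
    where open ≡-Reasoning

  data Calm : State → Set where
    start : Calm start
    short : ∀ {e} → Calm (ending e short)
    long  : ∀ {e} → Calm (ending e long)

  calm-step : ∀ {s} → Calm s → ∀ c → ∃ λ r → step s c ≡ ending c r
  calm-step start c = short , refl
  calm-step (short {e}) c with c ≟ᴬ e
  ... | yes refl = long , refl
  ... | no  _    = short , refl
  calm-step (long {e}) c with c ≟ᴬ e
  ... | yes refl = long , refl
  ... | no  _    = shortAfterLong , refl

  alternate : ∀ {c d} r → c ≢ d → run (ending c r) (d ∷ c ∷ d ∷ []) ≡ ending d short
  alternate {c} {d} r c≢d = begin
      run (ending c r) (d ∷ c ∷ d ∷ [])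
        ≡⟨ cong (λ s → run s (c ∷ d ∷ [])) (step-other r (c≢d ∘ sym)) ⟩
      run (ending d (next r)) (c ∷ d ∷ [])
        ≡⟨ cong (λ s → step s d) (step-other (next r) c≢d) ⟩
      step (ending c (next (next r))) d
        ≡⟨ cong (λ r' → step (ending c r') d) (next-next r) ⟩
      step (ending c short) d
        ≡⟨ step-other short (c≢d ∘ sym) ⟩
      ending d short ∎
    where
    open ≡-Reasoning
    next-next : ∀ r → next (next r) ≡ short
    next-next short          = refl
    next-next shortAfterLong = refl
    next-next long           = refl

  calm-cdcd : ∀ {s} → Calm s → ∀ {c d} → c ≢ d → run s (c ∷ d ∷ c ∷ d ∷ []) ≡ ending d short
  calm-cdcd calm {c} c≢d with calm-step calm c
  ... | r , e = trans (cong (λ s' → run s' (_ ∷ c ∷ _ ∷ [])) e) (alternate r c≢d)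

  repeat-calm : ∀ m c {r} → Calm (ending c r) → Calm (run (ending c r) (replicate m c))
  repeat-calm zero    c calm  = calm
  repeat-calm (suc m) c short = subst (λ s → Calm (run s (replicate m c))) (sym (step-same c short)) (repeat-calm m c long)
  repeat-calm (suc m) c long  = subst (λ s → Calm (run s (replicate m c))) (sym (step-same c long))  (repeat-calm m c long)

  replicate-calm : ∀ e m c → Calm (run (ending e short) (replicate m c))
  replicate-calm e zero    c = short
  replicate-calm e (suc m) c with c ≟ᴬ e
  ... | yes refl = repeat-calm m c long
  ... | no  _    = repeat-calm m c short

  run-fixed : ∀ {B : Set} {q} (f : B → List A) → (∀ b → run q (f b) ≡ q) → ∀ bs → run q (concatMap f bs) ≡ q
  run-fixed f fixed []       = refl
  run-fixed {q = q} f fixed (b ∷ bs) =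
    trans (foldl-++ step q (f b) (concatMap f bs))
          (trans (cong (λ s → run s (concatMap f bs)) (fixed b)) (run-fixed f fixed bs))

module _ {n : ℕ} where
  open Scanner (_≟_ {n})

  accepted-avoids : ∀ k' l' {v : List (Fin n)} → Accepted v →
                    Avoids (pattern-akbl (suc (suc k')) (suc (suc l'))) v
  accepted-avoids k' l' {v} accepted occ
    with occurs-aabb (occurs-factor (replicate k' false) (false ∷ false ∷ true ∷ true ∷ []) (replicate l' true)
                        (subst (λ t → Occurs t v) (pattern-middle k' l') occ))
  ... | _ , _ , p , s , α≢β , e = accepted-no-aabb p s α≢β e accepted

module _ {n : ℕ} where

  -- The letters kept by restrict L x z; oneOf? is the very filter it uses.
  OneOf : Fin n → Fin n → Fin n → Set
  OneOf x z c = c ≡ x ⊎ c ≡ z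

  oneOf? : ∀ x z → Decidable (OneOf x z)
  oneOf? x z c = (c ≟ x) ⊎-dec (c ≟ z)

  restrict-++ : ∀ u v {x z} → restrict (u ++ v) x z ≡ restrict u x z ++ restrict v x z
  restrict-++ u v {x} {z} = filter-++ (oneOf? x z) u v

  restrict-concatMap : ∀ {B : Set} (f : B → List (Fin n)) bs {x z} →
                       restrict (concatMap f bs) x z ≡ concatMap (λ b → restrict (f b) x z) bs
  restrict-concatMap f []       = refl
  restrict-concatMap f (b ∷ bs) =
    trans (restrict-++ (f b) (concatMap f bs)) (cong (_ ++_) (restrict-concatMap f bs))

  restrict-comm : ∀ L {x z} → restrict L x z ≡ restrict L z x
  restrict-comm L {x} {z} = filter-≐ (oneOf? x z) (oneOf? z x) (Sum.swap , Sum.swap) L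

  restrict-replicate-in : ∀ m {u x z} → OneOf x z u → restrict (replicate m u) x z ≡ replicate m u
  restrict-replicate-in m {x = x} {z} pu = filter-all (oneOf? x z) (replicate⁺ m pu)

  restrict-replicate-out : ∀ m {u x z} → ¬ OneOf x z u → restrict (replicate m u) x z ≡ []
  restrict-replicate-out m {x = x} {z} ¬pu = filter-none (oneOf? x z) (replicate⁺ m ¬pu)

  restrict-single : ∀ {L x z} → Unique L → x ∈ L → z ∉ L → restrict L x z ≡ x ∷ []
  restrict-single {x = x} {z} (h∉t ∷ _) (here refl) z∉L =
    trans (filter-accept (oneOf? x z) (inj₁ refl))
          (cong (x ∷_) (filter-none (oneOf? x z) (All.tabulate outside)))
    where
    outside : ∀ {c} → c ∈ _ → ¬ OneOf x z c
    outside c∈t (inj₁ refl) = All.lookup h∉t c∈t refl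
    outside c∈t (inj₂ refl) = z∉L (there c∈t)
  restrict-single {h ∷ _} {x} {z} (h∉t ∷ ut) (there x∈t) z∉L =
    trans (filter-reject (oneOf? x z) h-out) (restrict-single ut x∈t (z∉L ∘ there))
    where
    h-out : ¬ OneOf x z h
    h-out (inj₁ refl) = All.lookup h∉t x∈t refl
    h-out (inj₂ refl) = z∉L (here refl)

  restrict-pair : ∀ {L x z} → Unique L → x ∈ L → z ∈ L → x ≢ z →
                  restrict L x z ≡ x ∷ z ∷ [] ⊎ restrict L x z ≡ z ∷ x ∷ []
  restrict-pair (_ ∷ _) (here refl) (here refl) x≢z = ⊥-elim (x≢z refl)
  restrict-pair {_ ∷ t} {x} {z} (h∉t ∷ ut) (here refl) (there z∈t) _ =
    inj₁ (trans (filter-accept (oneOf? x z) (inj₁ refl))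
                (cong (x ∷_) (trans (restrict-comm t)
                                    (restrict-single ut z∈t (λ x∈t → All.lookup h∉t x∈t refl)))))
  restrict-pair {_} {x} {z} (h∉t ∷ ut) (there x∈t) (here refl) _ =
    inj₂ (trans (filter-accept (oneOf? x z) (inj₂ refl))
                (cong (z ∷_) (restrict-single ut x∈t (λ z∈t → All.lookup h∉t z∈t refl))))
  restrict-pair {h ∷ t} {x} {z} (h∉t ∷ ut) (there x∈t) (there z∈t) x≢z =
    Sum.map (trans skip) (trans skip) (restrict-pair ut x∈t z∈t x≢z)
    where
    h-out : ¬ OneOf x z h
    h-out (inj₁ refl) = All.lookup h∉t x∈t refl
    h-out (inj₂ refl) = All.lookup h∉t z∈t refl
    skip : restrict (h ∷ t) x z ≡ restrict t x z
    skip = filter-reject (oneOf? x z) h-out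

module Construction (k l : ℕ) {n : ℕ} (G : SimpleGraph n) where
  open SimpleGraph G using (adj) renaming (sym to adj-sym)
  open Scanner (_≟_ {n})

  block : Fin n → Fin n → List (Fin n)
  block u v with adj u v | u ≟ v
  ... | true  | _     = []
  ... | false | yes _ = []
  ... | false | no  _ = replicate k u ++ replicate l v

  separator : List (Fin n)
  separator = allFin n ++ allFin n

  piece : Fin n × Fin n → List (Fin n)
  piece (u , v) = block u v ++ separator

  word : List (Fin n)
  word = separator ++ concatMap piece (cartesianProduct (allFin n) (allFin n))

  word-covers : ∀ x → x ∈ word
  word-covers x = ∈-++⁺ˡ (∈-++⁺ˡ (∈-allFin x))

  block-nonadjacent : ∀ {x y} → x ≢ y → adj x y ≡ false → block x y ≡ replicate k x ++ replicate l y
  block-nonadjacent {x} {y} x≢y nonadj with adj x y | x ≟ y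
  ... | true  | _     = ⊥-elim (true≢false nonadj) where true≢false : true ≢ false ; true≢false ()
  ... | false | yes e = ⊥-elim (x≢y e)
  ... | false | no  _ = refl

  block-view : ∀ u v → block u v ≡ [] ⊎ (u ≢ v × adj u v ≡ false × block u v ≡ replicate k u ++ replicate l v)
  block-view u v with adj u v | u ≟ v
  ... | true  | _       = inj₁ refl
  ... | false | yes _   = inj₁ refl
  ... | false | no  u≢v = inj₂ (u≢v , refl , refl)

  word-contains-block : ∀ x y → ∃₂ λ p s → word ≡ p ++ block x y ++ s
  word-contains-block x y
    with ys , zs , pairs≡ ← ∈-∃++ (∈-cartesianProduct⁺ (∈-allFin x) (∈-allFin y)) =
    separator ++ concatMap piece ys , separator ++ concatMap piece zs , (begin
      separator ++ concatMap piece (cartesianProduct (allFin n) (allFin n))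
        ≡⟨ cong (λ ps → separator ++ concatMap piece ps) pairs≡ ⟩
      separator ++ concatMap piece (ys ++ (x , y) ∷ zs)
        ≡⟨ cong (separator ++_) (concatMap-++ piece ys _) ⟩
      separator ++ concatMap piece ys ++ (block x y ++ separator) ++ concatMap piece zs
        ≡⟨ sym (++-assoc separator (concatMap piece ys) _) ⟩
      (separator ++ concatMap piece ys) ++ (block x y ++ separator) ++ concatMap piece zs
        ≡⟨ cong ((separator ++ concatMap piece ys) ++_) (++-assoc (block x y) separator _) ⟩
      (separator ++ concatMap piece ys) ++ block x y ++ separator ++ concatMap piece zs ∎)
    where open ≡-Reasoning

  nonadjacent-occurs : ∀ {x y} → x ≢ y → adj x y ≡ false → Occurs (pattern-akbl k l) (restrict word x y)
  nonadjacent-occurs {x} {y} x≢y nonadj with word-contains-block x y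
  ... | p , s , word≡ = subst (λ v → Occurs (pattern-akbl k l) (restrict v x y)) (sym word≡)
      (subst (Occurs (pattern-akbl k l)) (sym restricted)
        (occurs-in-factor (restrict p x y) (restrict s x y)
          (subst (Isomorphic (pattern-akbl k l)) (sym block≡) (two-letter-isomorphic k l x≢y))))
    where
    restricted : restrict (p ++ block x y ++ s) x y ≡ restrict p x y ++ restrict (block x y) x y ++ restrict s x y
    restricted = trans (restrict-++ p _) (cong (_ ++_) (restrict-++ (block x y) s))
    block≡ : restrict (block x y) x y ≡ replicate k x ++ replicate l y
    block≡ = begin
      restrict (block x y) x y
        ≡⟨ cong (λ b → restrict b x y) (block-nonadjacent x≢y nonadj) ⟩
      restrict (replicate k x ++ replicate l y) x y
        ≡⟨ restrict-++ (replicate k x) _ ⟩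
      restrict (replicate k x) x y ++ restrict (replicate l y) x y
        ≡⟨ cong₂ _++_ (restrict-replicate-in k (inj₁ refl)) (restrict-replicate-in l (inj₂ refl)) ⟩
      replicate k x ++ replicate l y ∎
      where open ≡-Reasoning

  avoids⇒adjacent : ∀ {x y} → x ≢ y → Avoids (pattern-akbl k l) (restrict word x y) → adj x y ≡ true
  avoids⇒adjacent {x} {y} x≢y avoids with adj x y in nonadj
  ... | true  = refl
  ... | false = ⊥-elim (avoids (nonadjacent-occurs x≢y nonadj))

  edge-endpoints : ∀ {x z u v} → adj x z ≡ true → u ≢ v → OneOf x z u → OneOf x z v → adj u v ≡ true
  edge-endpoints edge u≢v (inj₁ refl) (inj₁ refl) = ⊥-elim (u≢v refl)
  edge-endpoints edge u≢v (inj₁ refl) (inj₂ refl) = edge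
  edge-endpoints {x} {z} edge u≢v (inj₂ refl) (inj₁ refl) = trans (adj-sym z x) edge
  edge-endpoints edge u≢v (inj₂ refl) (inj₂ refl) = ⊥-elim (u≢v refl)

  restrict-block : ∀ {x z} → adj x z ≡ true → ∀ u v → ∃₂ λ m c → restrict (block u v) x z ≡ replicate m c
  restrict-block {x} {z} edge u v with block-view u v
  ... | inj₁ empty = 0 , x , cong (λ b → restrict b x z) empty
  ... | inj₂ (u≢v , nonadj , block≡) rewrite block≡ | restrict-++ (replicate k u) (replicate l v) {x} {z}
    with oneOf? x z u | oneOf? x z v
  ... | yes pu | yes pv = ⊥-elim (true≢false (trans (sym (edge-endpoints edge u≢v pu pv)) nonadj))
    where true≢false : true ≢ false ; true≢false ()
  ... | yes pu | no ¬pv = k , u , trans (cong₂ _++_ (restrict-replicate-in k pu) (restrict-replicate-out l ¬pv))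
                                        (++-identityʳ (replicate k u))
  ... | no ¬pu | yes pv = l , v , cong₂ _++_ (restrict-replicate-out k ¬pu) (restrict-replicate-in l pv)
  ... | no ¬pu | no ¬pv = 0 , u , cong₂ _++_ (restrict-replicate-out k ¬pu) (restrict-replicate-out l ¬pv)

  restrict-separator : ∀ {x z} → x ≢ z → ∃₂ λ c d → c ≢ d × restrict separator x z ≡ c ∷ d ∷ c ∷ d ∷ []
  restrict-separator {x} {z} x≢z
    with restrict-pair (allFin⁺ n) (∈-allFin x) (∈-allFin z) x≢z
  ... | inj₁ e = x , z , x≢z , trans (restrict-++ (allFin n) (allFin n)) (cong₂ _++_ e e)
  ... | inj₂ e = z , x , x≢z ∘ sym , trans (restrict-++ (allFin n) (allFin n)) (cong₂ _++_ e e)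

  -- Adjacent x ≠ z: the scanner accepts w|xz, returning to one state
  -- after the initial separator and after every piece.
  adjacent-accepted : ∀ {x z} → x ≢ z → adj x z ≡ true → Accepted (restrict word x z)
  adjacent-accepted {x} {z} x≢z edge with restrict-separator x≢z
  ... | c , d , c≢d , separator≡ = λ died → dead≢hub (trans (sym died) accepted-run)
    where
    open ≡-Reasoning
    hub : State
    hub = ending d short
    dead≢hub : dead ≢ hub
    dead≢hub ()
    piece-fixed : ∀ uv → run hub (restrict (piece uv) x z) ≡ hub
    piece-fixed (u , v) with restrict-block edge u v
    ... | m , c' , block≡ = begin
      run hub (restrict (block u v ++ separator) x z)
        ≡⟨ cong (run hub) (trans (restrict-++ (block u v) separator) (cong₂ _++_ block≡ separator≡)) ⟩
      run hub (replicate m c' ++ c ∷ d ∷ c ∷ d ∷ [])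
        ≡⟨ foldl-++ step hub (replicate m c') _ ⟩
      run (run hub (replicate m c')) (c ∷ d ∷ c ∷ d ∷ [])
        ≡⟨ calm-cdcd (replicate-calm d m c') c≢d ⟩
      hub ∎
    pairs = cartesianProduct (allFin n) (allFin n)
    accepted-run : run start (restrict word x z) ≡ hub
    accepted-run = begin
      run start (restrict word x z)
        ≡⟨ cong (run start) (restrict-++ separator (concatMap piece pairs)) ⟩
      run start (restrict separator x z ++ restrict (concatMap piece pairs) x z)
        ≡⟨ foldl-++ step start (restrict separator x z) _ ⟩
      run (run start (restrict separator x z)) (restrict (concatMap piece pairs) x z)
        ≡⟨ cong₂ run (trans (cong (run start) separator≡) (calm-cdcd start c≢d)) (restrict-concatMap piece pairs) ⟩
      run hub (concatMap (λ uv → restrict (piece uv) x z) pairs)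
        ≡⟨ run-fixed (λ uv → restrict (piece uv) x z) piece-fixed pairs ⟩
      hub ∎

theorem8 : (k l : ℕ) → 2 ≤ k → 2 ≤ l →
    (n : ℕ) (G : SimpleGraph n) → Representable (pattern-akbl k l) G
theorem8 (suc (suc k')) (suc (suc l')) (s≤s (s≤s z≤n)) (s≤s (s≤s z≤n)) n G =
  word , word-covers , λ x y x≢y →
    mk⇔ (λ edge → accepted-avoids k' l' (adjacent-accepted x≢y edge)) (avoids⇒adjacent x≢y)
  where open Construction (suc (suc k')) (suc (suc l')) G
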